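{- Let $d\in\mathbb{N}$ and let $G$ be a finite graph with vertices $v_0,v_1$ whose distance is at most $d/2$ and at least three; let $C=C_d(v_0,v_1,G)$. Let $x$ be a neighbour of $v_0$ and $y$ a neighbour of $v_1$ in the explorer neighbourhood $Ex_d(v_0,v_1)$, such that $x$ and $y$ lie in the same component $K$ of $Ex_d(v_0,v_1)-v_0-v_1$. Then $x'$ and $y'$ lie in the same component of $C$.
   Context: All graphs are finite, without loops or parallel edges. For a vertex $v$ and $d\in\mathbb{N}$, the ball $D_d(v)$ is the subgraph of $G$ consisting of all vertices and edges of $G$ lying on some closed walk of length at most $d$ containing $v$. For vertices $v,w$ of distance at most $d/2$, the explorer neighbourhood $Ex_d(v,w)$ is defined as follows. The core is the set of all vertices on shortest $v$–$w$ paths in $G$. Take a copy of $D_d(v)$ in which each vertex $u$ is labelled with the set of shortest paths from the core to $u$ contained in $D_d(v)$, and a copy of $D_d(w)$ in which each vertex $u$ is labelled with the set of shortest paths from the core to $u$ contained in $D_d(w)$. $Ex_d(v,w)$ is the union of these two labelled balls, where two vertices (copies of the same vertex of $G$) are identified if their label sets share an element. For a vertex $x$ of $Ex_d(v,w)$, $x'$ denotes the vertex of $G$ of which $x$ is a copy. Core vertices (in particular $v,w$) have unique copies, denoted by the same letters. For $X\subseteq V(G)$, $N(X)$ is the set of vertices outside $X$ with a neighbour in $X$. The connectivity graph $C_d(v_0,v_1,G)$ has vertex set $N(\{v_0,v_1\})$, and $xy$ is an edge if there is an $x$–$y$ path in $D_d(v_i)-v_0-v_1$ for some $i\in\{0,1\}$.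 -}

module Defs where

open import Data.Nat using (ℕ; zero; suc; _*_; _≤_; s≤s; z≤n)
open import Data.Fin using (Fin)
open import Data.Bool using (Bool; true; false)
open import Data.List using (List; []; _∷_; _++_; length; head; last)
open import Data.List.Membership.Propositional using (_∈_)
open import Data.List.Relation.Unary.All using (All)
open import Data.List.Relation.Unary.Any using (here)
open import Data.List.Relation.Unary.Linked using (Linked; [-])
open import Data.Maybe using (just)
open import Data.Product using (∃-syntax; _×_; _,_)
open import Data.Sum using (_⊎_)
open import Relation.Nullary using (¬_)
open import Relation.Binary.PropositionalEquality using (_≡_; refl)
open import Relation.Binary.Construct.Closure.ReflexiveTransitive using (Star)

record Graph : Set₁ where
  field
    n        : ℕ
    _~_      : Fin n → Fin n → Set
    ~-sym    : ∀ {a b} → a ~ b → b ~ a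
    ~-irrefl : ∀ {a} → ¬ (a ~ a)

  V : Set
  V = Fin n

module _ (G : Graph) where
  open Graph G

  -- a walk from a to b, given by its vertex sequence; its length is
  -- (length ws - 1)
  IsWalk : V → V → List V → Set
  IsWalk a b ws = Linked _~_ ws × head ws ≡ just a × last ws ≡ just b

  Consec : List V → V → V → Set
  Consec ws a b = ∃[ pre ] ∃[ post ] ws ≡ pre ++ (a ∷ b ∷ post)

  EdgeOn : List V → V → V → Set
  EdgeOn ws a b = Consec ws a b ⊎ Consec ws b a

  ClosedWalkThrough : ℕ → V → List V → Set
  ClosedWalkThrough d v ws =
    (∃[ a ] IsWalk a a ws) × length ws ≤ suc d × v ∈ ws

  BallV : ℕ → V → V → Set
  BallV d v u = ∃[ ws ] ClosedWalkThrough d v ws × u ∈ ws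

  BallE : ℕ → V → V → V → Set
  BallE d v a b = ∃[ ws ] ClosedWalkThrough d v ws × EdgeOn ws a b

  DistAtMost : V → V → ℕ → Set
  DistAtMost a b k = ∃[ ws ] IsWalk a b ws × length ws ≤ suc k

  DistAtLeast : V → V → ℕ → Set
  DistAtLeast a b k = ∀ ws → IsWalk a b ws → suc k ≤ length ws

  DistAtMostHalf : ℕ → V → V → Set
  DistAtMostHalf d a b = ∃[ k ] 2 * k ≤ d × DistAtMost a b k

  IsShortestPath : V → V → List V → Set
  IsShortestPath a b ws =
    IsWalk a b ws × (∀ ws′ → IsWalk a b ws′ → length ws ≤ length ws′)

  Core : V → V → V → Set
  Core v w c = ∃[ ws ] IsShortestPath v w ws × c ∈ ws

  ShortestFromCore : V → V → V → List V → Set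
  ShortestFromCore v w u ws =
    (∃[ c ] Core v w c × IsWalk c u ws)
    × (∀ c′ ws′ → Core v w c′ → IsWalk c′ u ws′ → length ws ≤ length ws′)

  ContainedInBall : ℕ → V → List V → Set
  ContainedInBall d z ws = All (BallV d z) ws × Linked (BallE d z) ws

  -- ws belongs to the label of (the copy of) u in the ball D_d(z)
  Label : ℕ → V → V → V → V → List V → Set
  Label d v w z u ws = ShortestFromCore v w u ws × ContainedInBall d z ws

  module Explorer (d : ℕ) (v w : V) where

    centre : Bool → V
    centre false = v
    centre true  = w

    -- a vertex of the disjoint union of the two balls
    -- (side false: copy in D_d(v), side true: copy in D_d(w))
    record ExV : Set where
      constructor ex
      field
        side   : Bool
        vert   : V          -- x′
        inBall : BallV d (centre side) vert
    open ExV public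

    -- identification of copies: same ball and same vertex, or copies of the
    -- same vertex in the two balls whose label sets share an element
    _≈_ : ExV → ExV → Set
    x ≈ y = vert x ≡ vert y
          × (side x ≡ side y
             ⊎ ∃[ ws ] Label d v w (centre (side x)) (vert x) ws
                     × Label d v w (centre (side y)) (vert y) ws)

    ExAdj : ExV → ExV → Set
    ExAdj x y = ∃[ x̃ ] ∃[ ỹ ] x ≈ x̃ × y ≈ ỹ × side x̃ ≡ side ỹ
              × BallE d (centre (side x̃)) (vert x̃) (vert ỹ)

    vᴱ : ExV
    vᴱ = ex false v ((v ∷ []) , ((v , ([-] , refl , refl)) , s≤s z≤n , here refl) , here refl)

    wᴱ : ExV
    wᴱ = ex true w ((w ∷ []) , ((w , ([-] , refl , refl)) , s≤s z≤n , here refl) , here refl)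

    NotVW : ExV → Set
    NotVW x = ¬ (x ≈ vᴱ) × ¬ (x ≈ wᴱ)

    AdjMinus : ExV → ExV → Set
    AdjMinus x y = NotVW x × NotVW y × ExAdj x y

    SameComponentEx : ExV → ExV → Set
    SameComponentEx x y = NotVW x × NotVW y × Star AdjMinus x y

  module Connectivity (d : ℕ) (v₀ v₁ : V) where

    -- N({v₀,v₁}): the vertex set of C_d(v₀,v₁,G)
    InN : V → Set
    InN u = ¬ (u ≡ v₀) × ¬ (u ≡ v₁) × (u ~ v₀ ⊎ u ~ v₁)

    centreC : Bool → V
    centreC false = v₀
    centreC true  = v₁

    WalkInBallMinus : Bool → V → V → List V → Set
    WalkInBallMinus i a b ws =
      Linked (BallE d (centreC i)) ws × head ws ≡ just a × last ws ≡ just b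
      × All (λ u → BallV d (centreC i) u × ¬ (u ≡ v₀) × ¬ (u ≡ v₁)) ws

    CAdj : V → V → Set
    CAdj a b = InN a × InN b × (∃[ i ] ∃[ ws ] WalkInBallMinus i a b ws)

    SameComponentC : V → V → Set
    SameComponentC a b = InN a × InN b × Star CAdj a b

-- Follow a path of Ex_d(v₀,v₁) − v₀ − v₁ from x to y. Each of its edges lies in one of
-- the balls D_d(v₀), D_d(v₁), and a run of edges in the same ball is a walk in that ball
-- avoiding v₀ and v₁, hence joins its end vertices in C as soon as they lie in N({v₀,v₁}).
-- Where the path changes balls its current vertex u is a copy identified across the two
-- balls through a common label: a shortest path P from the core to u lying in both balls.
-- As dist(v₀,v₁) ≤ d/2, a shortest v₀–v₁ path Q goes out and back within d steps, so Q lies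
-- in both balls too. Following P back to the core and then Q to v₁, the last vertex before
-- {v₀,v₁} is a vertex of N({v₀,v₁}) joined to u in both balls minus v₀,v₁ (u is a hub),
-- where the walk changes balls. Core vertices have unique copies, so no vertex of
-- Ex_d(v₀,v₁) − v₀ − v₁ is a copy of v₀ or v₁; this needs a shortest v₀–v₁ path, which
-- exists up to double negation, enough for a negative statement.
module Submission where

open import Defs
open import Data.Nat using (ℕ; zero; suc; _+_; _*_; _≤_; s≤s; z≤n)
open import Data.Nat.Properties using (≤-trans; ≤-refl; ≤-pred; ≮⇒≥; *-monoʳ-≤; *-suc; +-comm)
open import Data.Fin using (_≟_)
open import Data.Bool using (Bool; true; false)
open import Data.List using (List; []; _∷_; _++_; _∷ʳ_; length; last)
open import Data.List.Properties using (++-assoc; length-++)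
open import Data.List.Membership.Propositional using (_∈_)
open import Data.List.Membership.Propositional.Properties using (∈-++⁺ˡ; ∈-++⁺ʳ)
open import Data.List.Relation.Unary.Any using (here; there)
open import Data.List.Relation.Unary.All using ([]; _∷_)
open import Data.List.Relation.Unary.Linked as Linked using (Linked; [-]; _∷_)
open import Data.List.Relation.Unary.Linked.Properties using (++⁺)
open import Data.Maybe using (just)
open import Data.Maybe.Relation.Binary.Connected using (Connected; just)
open import Data.Product using (∃-syntax; _×_; _,_; uncurry)
open import Data.Sum using (_⊎_; inj₁; inj₂)
open import Data.Empty using (⊥; ⊥-elim)
open import Relation.Nullary using (¬_; yes; no)
open import Relation.Binary.Definitions using (Symmetric)
open import Relation.Binary.PropositionalEquality
  using (_≡_; _≢_; refl; sym; cong; subst; module ≡-Reasoning)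
open import Relation.Binary.Construct.Closure.ReflexiveTransitive
  using (Star; ε; _◅_; _◅◅_; reverse)

module _ {A : Set} where

  Linked-consecutive : ∀ {R : A → A → Set} pre {a b post} →
                       Linked R (pre ++ a ∷ b ∷ post) → R a b
  Linked-consecutive []            (r ∷ _) = r
  Linked-consecutive (_ ∷ [])      (_ ∷ l) = Linked-consecutive [] l
  Linked-consecutive (_ ∷ p ∷ pre) (_ ∷ l) = Linked-consecutive (p ∷ pre) l

  Linked⇒Star : ∀ {R : A → A → Set} {a b} r →
                Linked R (a ∷ r) → last (a ∷ r) ≡ just b → Star R a b
  Linked⇒Star []      [-]     refl = ε
  Linked⇒Star (_ ∷ r) (x ∷ l) eq   = x ◅ Linked⇒Star r l eq

  Linked⇒Star-from : ∀ {R : A → A → Set} {c b} xs →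
                     c ∈ xs → Linked R xs → last xs ≡ just b → Star R c b
  Linked⇒Star-from (_ ∷ r)     (here refl) l       eq = Linked⇒Star r l eq
  Linked⇒Star-from (_ ∷ m ∷ r) (there c∈)  (_ ∷ l) eq = Linked⇒Star-from (m ∷ r) c∈ l eq

  last⇒∈ : ∀ xs {b : A} → last xs ≡ just b → b ∈ xs
  last⇒∈ (_ ∷ [])     refl = here refl
  last⇒∈ (_ ∷ m ∷ xs) eq   = there (last⇒∈ (m ∷ xs) eq)

  last-∷ʳ : ∀ (xs : List A) a → last (xs ∷ʳ a) ≡ just a
  last-∷ʳ []           a = refl
  last-∷ʳ (_ ∷ [])     a = refl
  last-∷ʳ (_ ∷ y ∷ xs) a = last-∷ʳ (y ∷ xs) a

  Linked-∷ʳ : ∀ {R : A → A → Set} {xs c a} →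
              Linked R xs → last xs ≡ just c → R c a → Linked R (xs ∷ʳ a)
  Linked-∷ʳ {R} {a = a} l eq r =
    ++⁺ l (subst (λ m → Connected R m (just a)) (sym eq) (just r)) [-]

  ¬¬-minimal : ∀ {P : A → Set} (f : A → ℕ) →
               ∃[ a ] P a → ¬ ¬ (∃[ a ] P a × (∀ b → P b → f a ≤ f b))
  ¬¬-minimal {P} f (a , pa) ¬min = noneBelow (f a) a pa ≤-refl
    where
    noneBelow : ∀ n a → P a → f a ≤ n → ⊥
    noneBelow zero    a pa fa≤n = ¬min (a , pa , λ _ _ → ≤-trans fa≤n z≤n)
    noneBelow (suc n) a pa fa≤n = ¬min (a , pa , λ b pb →
      ≮⇒≥ (λ fb<fa → noneBelow n b pb (≤-pred (≤-trans fb<fa fa≤n))))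

  -- roundTrip a r is a closed walk at a traversing every edge of the walk a ∷ r twice.
  excursion : A → List A → List A
  excursion a []      = []
  excursion a (b ∷ r) = (b ∷ excursion b r) ∷ʳ a

  roundTrip : A → List A → List A
  roundTrip a r = a ∷ excursion a r

  roundTrip-last : ∀ a r → last (roundTrip a r) ≡ just a
  roundTrip-last a []      = refl
  roundTrip-last a (b ∷ r) = last-∷ʳ (roundTrip b r) a

  roundTrip-⊇ : ∀ a r {x} → x ∈ a ∷ r → x ∈ roundTrip a r
  roundTrip-⊇ a []      x∈          = x∈
  roundTrip-⊇ a (b ∷ r) (here refl) = here refl
  roundTrip-⊇ a (b ∷ r) (there x∈)  = there (∈-++⁺ˡ (roundTrip-⊇ b r x∈))

  excursion-length : ∀ a r → length (excursion a r) ≡ 2 * length r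
  excursion-length a []      = refl
  excursion-length a (b ∷ r) = begin
    length (roundTrip b r ∷ʳ a)       ≡⟨ length-++ (roundTrip b r) ⟩
    suc (length (excursion b r)) + 1  ≡⟨ +-comm (suc (length (excursion b r))) 1 ⟩
    2 + length (excursion b r)        ≡⟨ cong (2 +_) (excursion-length b r) ⟩
    2 + 2 * length r                  ≡⟨ sym (*-suc 2 (length r)) ⟩
    2 * suc (length r)                ∎
    where open ≡-Reasoning

  roundTrip-linked : ∀ {R : A → A → Set} → Symmetric R →
                     ∀ a r → Linked R (a ∷ r) → Linked R (roundTrip a r)
  roundTrip-linked sym′ a []      _         = [-]
  roundTrip-linked sym′ a (b ∷ r) (rab ∷ l) =
    rab ∷ Linked-∷ʳ (roundTrip-linked sym′ b r l) (roundTrip-last b r) (sym′ rab)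

module _ (G : Graph) where
  open Graph G

  Consec-∷ : ∀ {ws a b} c → Consec G ws a b → Consec G (c ∷ ws) a b
  Consec-∷ c (pre , post , refl) = c ∷ pre , post , refl

  Consec-∷ʳ : ∀ {ws a b} c → Consec G ws a b → Consec G (ws ∷ʳ c) a b
  Consec-∷ʳ {a = a} {b} c (pre , post , refl) =
    pre , post ∷ʳ c , ++-assoc pre (a ∷ b ∷ post) (c ∷ [])

  roundTrip-consecutive : ∀ a r → Linked (Consec G (roundTrip a r)) (a ∷ r)
  roundTrip-consecutive a []      = [-]
  roundTrip-consecutive a (b ∷ r) =
    ([] , excursion b r ∷ʳ a , refl)
      ∷ Linked.map (λ c → Consec-∷ a (Consec-∷ʳ a c)) (roundTrip-consecutive b r)

  BallE⇒~ : ∀ {d z a b} → BallE G d z a b → a ~ b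
  BallE⇒~ (_ , ((_ , lk , _) , _) , inj₁ (pre , _ , refl)) = Linked-consecutive pre lk
  BallE⇒~ (_ , ((_ , lk , _) , _) , inj₂ (pre , _ , refl)) = ~-sym (Linked-consecutive pre lk)

  BallE-sym : ∀ {d z a b} → BallE G d z a b → BallE G d z b a
  BallE-sym (ws , c , inj₁ e) = ws , c , inj₂ e
  BallE-sym (ws , c , inj₂ e) = ws , c , inj₁ e

  BallE⇒BallVˡ : ∀ {d z a b} → BallE G d z a b → BallV G d z a
  BallE⇒BallVˡ (ws , c , inj₁ (pre , _ , refl)) = ws , c , ∈-++⁺ʳ pre (here refl)
  BallE⇒BallVˡ (ws , c , inj₂ (pre , _ , refl)) = ws , c , ∈-++⁺ʳ pre (there (here refl))

  BallE⇒BallVʳ : ∀ {d z a b} → BallE G d z a b → BallV G d z b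
  BallE⇒BallVʳ e = BallE⇒BallVˡ (BallE-sym e)

  walk⊆ball : ∀ {d a r z} → Linked _~_ (a ∷ r) → 2 * length r ≤ d → z ∈ a ∷ r →
              Linked (BallE G d z) (a ∷ r)
  walk⊆ball {d} {a} {r} {z} walk short z∈ =
    Linked.map (λ c → roundTrip a r , closed , inj₁ c) (roundTrip-consecutive a r)
    where
    closed : ClosedWalkThrough G d z (roundTrip a r)
    closed = (a , roundTrip-linked ~-sym a r walk , refl , roundTrip-last a r)
           , s≤s (subst (_≤ d) (sym (excursion-length a r)) short)
           , roundTrip-⊇ a r z∈

module ExplorerToConnectivity (G : Graph) (d : ℕ) (v₀ v₁ : Graph.V G) where
  open Graph G
  open Explorer G d v₀ v₁
  open Connectivity G d v₀ v₁

  Good : V → Set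
  Good u = u ≢ v₀ × u ≢ v₁

  centre≡centreC : ∀ i → centre i ≡ centreC i
  centre≡centreC false = refl
  centre≡centreC true  = refl

  Step : Bool → V → V → Set
  Step i a b = BallE G d (centreC i) a b × Good a × Good b

  Step-sym : ∀ {i} → Symmetric (Step i)
  Step-sym (e , ga , gb) = BallE-sym G e , gb , ga

  Star-Step⇒walk : ∀ {i a b} → Star (Step i) a b → BallV G d (centreC i) a → Good a →
                   ∃[ ws ] WalkInBallMinus i a b ws
  Star-Step⇒walk {a = a} ε ba ga = a ∷ [] , [-] , refl , refl , (ba , ga) ∷ []
  Star-Step⇒walk {a = a} ((e , _ , gm) ◅ p) ba ga
    with Star-Step⇒walk p (BallE⇒BallVʳ G e) gm
  ... | ws@(_ ∷ _) , lk , refl , lt , all = a ∷ ws , e ∷ lk , refl , lt , (ba , ga) ∷ all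

  Star-Step⇒Star-CAdj : ∀ {i a b} → InN a → InN b → Star (Step i) a b → Star CAdj a b
  Star-Step⇒Star-CAdj _   _   ε = ε
  Star-Step⇒Star-CAdj {i} a∈N b∈N p@((e , ga , _) ◅ _) =
    (a∈N , b∈N , i , Star-Step⇒walk p (BallE⇒BallVˡ G e) ga) ◅ ε

  Hub : V → Set
  Hub u = ∃[ z ] InN z × (∀ i → Star (Step i) u z)

  BothBalls : V → V → Set
  BothBalls a b = ∀ i → BallE G d (centreC i) a b

  bothBalls : ∀ {a b} → BallE G d v₀ a b → BallE G d v₁ a b → BothBalls a b
  bothBalls e₀ e₁ false = e₀
  bothBalls e₀ e₁ true  = e₁

  BothBalls-sym : Symmetric BothBalls
  BothBalls-sym e i = BallE-sym G (e i)

  walkToV₁⇒Hub : ∀ {u} → Star BothBalls u v₁ → Good u → Hub u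
  walkToV₁⇒Hub ε (_ , u≢v₁) = ⊥-elim (u≢v₁ refl)
  walkToV₁⇒Hub {u} (_◅_ {j = w} e p) (u≢v₀ , u≢v₁) with w ≟ v₀ | w ≟ v₁
  ... | yes refl | _        = u , (u≢v₀ , u≢v₁ , inj₁ (BallE⇒~ G (e false))) , λ _ → ε
  ... | no _     | yes refl = u , (u≢v₀ , u≢v₁ , inj₂ (BallE⇒~ G (e false))) , λ _ → ε
  ... | no w≢v₀  | no w≢v₁  with walkToV₁⇒Hub p (w≢v₀ , w≢v₁)
  ... | z , z∈N , w⇝z = z , z∈N , λ i → (e i , (u≢v₀ , u≢v₁) , (w≢v₀ , w≢v₁)) ◅ w⇝z i

  coreLabel : ∀ {c z} → Core G v₀ v₁ c → BallV G d z c → Label G d v₀ v₁ z c (c ∷ [])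
  coreLabel {c} core bc = ((c , core , [-] , refl , refl) , nonempty) , bc ∷ [] , [-]
    where
    nonempty : ∀ c′ ws′ → Core G v₀ v₁ c′ → IsWalk G c′ c ws′ → 1 ≤ length ws′
    nonempty _ (_ ∷ _) _ _            = s≤s z≤n
    nonempty _ []      _ (_ , () , _)

  core-uniqueCopy : ∀ {c} → Core G v₀ v₁ c → (a b : ExV) → vert a ≡ c → vert b ≡ c → a ≈ b
  core-uniqueCopy core (ex _ c ba) (ex _ .c bb) refl refl =
    refl , inj₂ (c ∷ [] , coreLabel core ba , coreLabel core bb)

  ExAdj⇒~ : ∀ {a b} → ExAdj a b → vert a ~ vert b
  ExAdj⇒~ {ex _ _ _} {ex _ _ _} (ex _ _ _ , ex _ _ _ , (refl , _) , (refl , _) , _ , e) =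
    BallE⇒~ G e

  ShortestPath : Set
  ShortestPath = ∃[ Q ] IsShortestPath G v₀ v₁ Q

  ¬¬shortestPath : DistAtMostHalf G d v₀ v₁ → ¬ ¬ ShortestPath
  ¬¬shortestPath (_ , _ , R , walkR , _) = ¬¬-minimal length (R , walkR)

  shortestPath-short : DistAtMostHalf G d v₀ v₁ →
                       ∀ {q r} → IsShortestPath G v₀ v₁ (q ∷ r) → 2 * length r ≤ d
  shortestPath-short (k , 2k≤d , R , walkR , |R|≤1+k) (_ , minimal) =
    ≤-trans (*-monoʳ-≤ 2 (≤-pred (≤-trans (minimal R walkR) |R|≤1+k))) 2k≤d

  v₀∈core : ShortestPath → Core G v₀ v₁ v₀
  v₀∈core (Q@(_ ∷ _) , sp@((_ , refl , _) , _)) = Q , sp , here refl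

  v₁∈core : ShortestPath → Core G v₀ v₁ v₁
  v₁∈core (Q , sp@((_ , _ , lastQ) , _)) = Q , sp , last⇒∈ Q lastQ

  module _ (dist : DistAtMostHalf G d v₀ v₁) where

    shortestPath⊆bothBalls : ∀ {Q} → IsShortestPath G v₀ v₁ Q → Linked BothBalls Q
    shortestPath⊆bothBalls {_ ∷ r} sp@((walk , refl , lastQ) , _) =
      Linked.zipWith (uncurry bothBalls)
        (walk⊆ball G walk short (here refl) , walk⊆ball G walk short (last⇒∈ (v₀ ∷ r) lastQ))
      where
      short : 2 * length r ≤ d
      short = shortestPath-short dist sp

    core⇝v₁ : ∀ {c} → Core G v₀ v₁ c → Star BothBalls c v₁
    core⇝v₁ (Q , sp@((_ , _ , lastQ) , _) , c∈Q) =
      Linked⇒Star-from Q c∈Q (shortestPath⊆bothBalls sp) lastQ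

    sharedLabel⇒Hub : ∀ {u ws} → Good u →
                      Label G d v₀ v₁ v₀ u ws → Label G d v₀ v₁ v₁ u ws → Hub u
    sharedLabel⇒Hub {u} {c ∷ r} gu
      (((c , core , _ , refl , lastP) , _) , _ , inBall₀) (_ , _ , inBall₁) =
      walkToV₁⇒Hub (reverse BothBalls-sym c⇝u ◅◅ core⇝v₁ core) gu
      where
      c⇝u : Star BothBalls c u
      c⇝u = Linked⇒Star r (Linked.zipWith (uncurry bothBalls) (inBall₀ , inBall₁)) lastP

    NotVW⇒Good : ∀ x → NotVW x → Good (vert x)
    NotVW⇒Good x (x≉v , x≉w) =
        (λ x≡v₀ → ¬¬shortestPath dist λ sp → x≉v (core-uniqueCopy (v₀∈core sp) x vᴱ x≡v₀ refl))
      , (λ x≡v₁ → ¬¬shortestPath dist λ sp → x≉w (core-uniqueCopy (v₁∈core sp) x wᴱ x≡v₁ refl))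

    ≈⇒sameSide⊎Hub : ∀ {a b} → Good (vert a) → a ≈ b → side a ≡ side b ⊎ Hub (vert a)
    ≈⇒sameSide⊎Hub _ (_ , inj₁ same) = inj₁ same
    ≈⇒sameSide⊎Hub {ex false _ _} {ex false _ _} _ (_ , inj₂ _) = inj₁ refl
    ≈⇒sameSide⊎Hub {ex true  _ _} {ex true  _ _} _ (_ , inj₂ _) = inj₁ refl
    ≈⇒sameSide⊎Hub {ex false _ _} {ex true  _ _} g (refl , inj₂ (_ , ℓ₀ , ℓ₁)) =
      inj₂ (sharedLabel⇒Hub g ℓ₀ ℓ₁)
    ≈⇒sameSide⊎Hub {ex true  _ _} {ex false _ _} g (refl , inj₂ (_ , ℓ₁ , ℓ₀)) =
      inj₂ (sharedLabel⇒Hub g ℓ₀ ℓ₁)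

    record Anchored (x₀ : V) (i : Bool) (u : V) : Set where
      constructor anchored
      field
        anchor    : V
        anchor∈N  : InN anchor
        x₀⇝anchor : Star CAdj x₀ anchor
        anchor⇝u  : Star (Step i) anchor u

    Anchored-extend : ∀ {x₀ i u w} → Anchored x₀ i u → Step i u w → Anchored x₀ i w
    Anchored-extend (anchored z z∈N x₀⇝z z⇝u) st = anchored z z∈N x₀⇝z (z⇝u ◅◅ st ◅ ε)

    Anchored-switch : ∀ {x₀ i u} j → Anchored x₀ i u → Hub u → Anchored x₀ j u
    Anchored-switch {i = i} j (anchored z z∈N x₀⇝z z⇝u) (h , h∈N , u⇝h) =
      anchored h h∈N (x₀⇝z ◅◅ Star-Step⇒Star-CAdj z∈N h∈N (z⇝u ◅◅ u⇝h i))
                     (reverse Step-sym (u⇝h j))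

    -- The ball of the anchoring walk may differ from the side of the copy a only if a is a
    -- hub; this is what allows the walk to follow the next edge of Ex in the other ball.
    record Reached (x₀ : V) (a : ExV) : Set where
      constructor reached
      field
        ball       : Bool
        anchoring  : Anchored x₀ ball (vert a)
        consistent : ball ≡ side a ⊎ Hub (vert a)

    Reached-start : ∀ x → InN (vert x) → Reached (vert x) x
    Reached-start x x∈N = reached (side x) (anchored (vert x) x∈N ε ε) (inj₁ refl)

    Reached-depart : ∀ {x₀ a ã} → Good (vert a) → Reached x₀ a → a ≈ ã →
                     Anchored x₀ (side ã) (vert a)
    Reached-depart {ã = ã} _ (reached _ anch (inj₂ hub)) _ = Anchored-switch (side ã) anch hub
    Reached-depart {a = a} {ã} g (reached _ anch (inj₁ refl)) a≈ã
      with ≈⇒sameSide⊎Hub {a} {ã} g a≈ã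
    ... | inj₁ refl = anch
    ... | inj₂ hub  = Anchored-switch (side ã) anch hub

    Reached-arrive : ∀ {x₀ b b̃} → Good (vert b) → Anchored x₀ (side b̃) (vert b) → b ≈ b̃ →
                     Reached x₀ b
    Reached-arrive {b = b} {b̃} g anch b≈b̃ with ≈⇒sameSide⊎Hub {b} {b̃} g b≈b̃
    ... | inj₁ same = reached _ anch (inj₁ (sym same))
    ... | inj₂ hub  = reached _ anch (inj₂ hub)

    Reached-step : ∀ {x₀ a b} → Reached x₀ a → AdjMinus a b → Reached x₀ b
    Reached-step {a = a@(ex _ u _)} {b@(ex _ w _)} r
      (a≉ , b≉ , ã@(ex t _ _) , b̃@(ex _ _ _) , a≈ã@(refl , _) , b≈b̃@(refl , _) , refl , e) =
      Reached-arrive {b = b} {b̃} gw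
        (Anchored-extend (Reached-depart {a = a} {ã} gu r a≈ã) edge) b≈b̃
      where
      gu : Good u
      gu = NotVW⇒Good a a≉
      gw : Good w
      gw = NotVW⇒Good b b≉
      edge : Step t u w
      edge = subst (λ c → BallE G d c u w) (centre≡centreC t) e , gu , gw

    Reached-path : ∀ {x₀ a b} → Reached x₀ a → Star AdjMinus a b → Reached x₀ b
    Reached-path r ε          = r
    Reached-path r (st ◅ sts) = Reached-path (Reached-step r st) sts

    Reached⇒Star-CAdj : ∀ {x₀ b} → InN (vert b) → Reached x₀ b → Star CAdj x₀ (vert b)
    Reached⇒Star-CAdj b∈N (reached _ (anchored z z∈N x₀⇝z z⇝b) _) =
      x₀⇝z ◅◅ Star-Step⇒Star-CAdj z∈N b∈N z⇝b

    neighbour⇒InN : ∀ x → NotVW x → ExAdj x vᴱ ⊎ ExAdj x wᴱ → InN (vert x)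
    neighbour⇒InN x x≉ x~ with NotVW⇒Good x x≉ | x~
    ... | x≢v₀ , x≢v₁ | inj₁ x~v = x≢v₀ , x≢v₁ , inj₁ (ExAdj⇒~ {x} {vᴱ} x~v)
    ... | x≢v₀ , x≢v₁ | inj₂ x~w = x≢v₀ , x≢v₁ , inj₂ (ExAdj⇒~ {x} {wᴱ} x~w)

lemma3p11 : (G : Graph) (d : ℕ) (v₀ v₁ : Graph.V G)
    → DistAtMostHalf G d v₀ v₁
    → DistAtLeast G v₀ v₁ 3
    → (x y : Explorer.ExV G d v₀ v₁)
    → Explorer.ExAdj G d v₀ v₁ x (Explorer.vᴱ G d v₀ v₁)
    → Explorer.ExAdj G d v₀ v₁ y (Explorer.wᴱ G d v₀ v₁)
    → Explorer.SameComponentEx G d v₀ v₁ x y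
    → Connectivity.SameComponentC G d v₀ v₁
        (Explorer.vert x) (Explorer.vert y)
lemma3p11 G d v₀ v₁ dist _ x y x~v y~w (x≉ , y≉ , x⇝y) =
  x∈N , y∈N , Reached⇒Star-CAdj dist y∈N (Reached-path dist (Reached-start dist x x∈N) x⇝y)
  where
  open ExplorerToConnectivity G d v₀ v₁
  open Connectivity G d v₀ v₁ using (InN)
  open Explorer G d v₀ v₁ using (vert)
  x∈N : InN (vert x)
  x∈N = neighbour⇒InN dist x x≉ (inj₁ x~v)
  y∈N : InN (vert y)
  y∈N = neighbour⇒InN dist y y≉ (inj₂ y~w)
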